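{- Let $k$ be a positive integer and let $a_1,b_1,\dots,a_k,b_k$ be non-negative integers such that $a_1\ge 1$, $b_k\ge 1$, and $a_i+b_i\ge 1$ for all $i\in\{1,\dots,k\}$. If $a_i+b_i\ge 2$ for at least one $i\in\{1,\dots,k\}$, then \[ \lim_{N\to\infty}\ \sum_{0<n_1<n_2<\cdots<n_k<N}\ \prod_{i=1}^k\frac{1}{(N-n_i)^{a_i}n_i^{b_i}}=0, \] where the sum is over integers $n_1,\dots,n_k$. -}

module Defs where

open import Data.Nat using (ℕ; zero; suc; _∸_; _^_) renaming (_+_ to _+ℕ_; _*_ to _*ℕ_)
open import Data.Integer using (+_)
open import Data.Fin using (Fin; zero; suc)
open import Data.List using (List; map; upTo; foldr)
open import Data.Rational using (ℚ; 0ℚ; 1ℚ; _/_; _+_; _*_)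

-- 1/d as a rational; the value at d = 0 is a dummy (0) and never used in
-- the sums below, where every denominator is positive.
invℕ : ℕ → ℚ
invℕ zero    = 0ℚ
invℕ (suc d) = + 1 / suc d

openRange : ℕ → ℕ → List ℕ
openRange lo N = map (λ i → suc lo +ℕ i) (upTo (N ∸ suc lo))

sumℚ : List ℚ → ℚ
sumℚ = foldr _+_ 0ℚ

factor : (N n e f : ℕ) → ℚ
factor N n e f = invℕ (((N ∸ n) ^ e) *ℕ (n ^ f))

-- nested sum  Σ_{lo < n_1 < ... < n_k < N} Π_i factor N n_i (a i) (b i)
nestedSum : (k : ℕ) → (a b : Fin k → ℕ) → (lo N : ℕ) → ℚ
nestedSum zero    a b lo N = 1ℚ
nestedSum (suc k) a b lo N =
  sumℚ (map (λ n → factor N n (a zero) (b zero) * nestedSum k (λ i → a (suc i)) (λ i → b (suc i)) n N)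
            (openRange lo N))

S : (k : ℕ) → (a b : Fin k → ℕ) → ℕ → ℚ
S k a b N = nestedSum k a b 0 N

-- Write u n = 1/(N - n), v n = 1/n, w = 1/N and Λ = 2 (1 + 1/2 + ... + 1/(N-1)). A factor
-- 1/((N - n)^a n^b) with a + b ≥ 1 is at most u n + v n, and any sum of u n + v n over a range of n
-- is at most Λ. The partial fraction identity u n v n = w (u n + v n), together with the monotonicity
-- of u, gives u n (Σ_{n<m<N} v m) ≤ w Λ. Summing out n₁, n₂, ... one variable at a time, the sums over
-- lo < n₁ < ... < n_k < N are bounded by Λ^k (every degree positive), by Λ^(k-1) Σ_{lo<n<N} v n (if
-- moreover b_k ≥ 1), by Λ^k v lo (if moreover some degree is ≥ 2), and finally by Λ^k w (if moreover
-- a₁ ≥ 1). So S_N ≤ Λ^k / N. Since Λ grows by 2/N from N to N + 1, each power Λ^r is O(N), so that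
-- S_N² ≤ Λ^(2k) / N² = O(1/N); this avoids logarithms, which ℚ does not have.
module Submission where

open import Defs

module Estimates where

  open import Data.Nat as ℕ
    using (ℕ; zero; suc; pred; _∸_; z≤n; s≤s; z<s; _≤′_; ≤′-refl; ≤′-step)
    renaming (_+_ to _+ℕ_; _*_ to _*ℕ_; _^_ to _^ℕ_; _≤_ to _≤ℕ_; _<_ to _<ℕ_)
  import Data.Nat.Properties as ℕP
  open import Data.Nat.Tactic.RingSolver using (solve-∀)
  open import Data.Nat.Coprimality using (1-coprimeTo)
  import Data.Integer as ℤ
  import Data.Integer.Properties as ℤP
  open import Data.Fin using (Fin; zero; suc; fromℕ)
  open import Data.Vec.Functional using (head; tail)
  open import Data.List using (map; applyUpTo)
  open import Data.List.Properties using (map-applyUpTo)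
  open import Data.Product using (∃; _,_)
  open import Data.Sum using (_⊎_; inj₁; inj₂)
  open import Data.Rational
    using (ℚ; 0ℚ; 1ℚ; _+_; _*_; _≤_; _<_; _/_; *≤*; *<*; mkℚ; Positive; positive; nonNegative)
  open import Data.Rational.Literals using (fromℤ)
  import Data.Rational.Properties as ℚP
  open import Data.Rational.Solver using (module +-*-Solver)
  open import Algebra.Bundles using (CommutativeRing)
  open CommutativeRing ℚP.+-*-commutativeRing
    using (semiring; *-commutativeSemigroup; +-commutativeSemigroup)
  open import Algebra.Properties.CommutativeSemigroup *-commutativeSemigroup
    using (interchange; xy∙z≈y∙xz; xy∙z≈zx∙y; x∙yz≈y∙xz)
  open import Algebra.Properties.CommutativeSemigroup +-commutativeSemigroup
    using () renaming (interchange to +-interchange)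
  open import Algebra.Properties.Semiring.Exp semiring using (_^_; ^-homo-*)
  open import Function using (_∘_; id)
  open import Relation.Binary.PropositionalEquality

  open +-*-Solver using (solve; _:=_; _:+_; _:*_; con)

  -- Rational arithmetic

  infix 8 ↑_

  ↑_ : ℕ → ℚ
  ↑ n = fromℤ (ℤ.+ n)

  ↑-/1 : ∀ n → ℤ.+ n / 1 ≡ ↑ n
  ↑-/1 n = ℚP.normalize-coprime _

  ↑1≡1 : ↑ 1 ≡ 1ℚ
  ↑1≡1 = sym (↑-/1 1)

  ↑-+ : ∀ m n → ↑ (m +ℕ n) ≡ ↑ m + ↑ n
  ↑-+ m n = trans (sym (↑-/1 (m +ℕ n))) (cong (_/ 1) (begin
    ℤ.+ (m +ℕ n)
      ≡⟨ ℤP.pos-+ m n ⟩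
    ℤ.+ m ℤ.+ ℤ.+ n
      ≡⟨ sym (cong₂ ℤ._+_ (ℤP.*-identityʳ (ℤ.+ m)) (ℤP.*-identityʳ (ℤ.+ n))) ⟩
    ℤ.+ m ℤ.* ℤ.+ 1 ℤ.+ ℤ.+ n ℤ.* ℤ.+ 1
      ∎))
    where open ≡-Reasoning

  ↑-suc : ∀ n → ↑ suc n ≡ 1ℚ + ↑ n
  ↑-suc n = trans (↑-+ 1 n) (cong (_+ ↑ n) ↑1≡1)

  ↑-* : ∀ m n → ↑ (m *ℕ n) ≡ ↑ m * ↑ n
  ↑-* m n = trans (sym (↑-/1 (m *ℕ n))) (cong (_/ 1) (ℤP.pos-* m n))

  ↑-mono-≤ : ∀ {m n} → m ≤ℕ n → ↑ m ≤ ↑ n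
  ↑-mono-≤ m≤n = *≤* (ℤP.*-monoʳ-≤-nonNeg (ℤ.+ 1) (ℤ.+≤+ m≤n))

  ↑-nonNeg : ∀ n → 0ℚ ≤ ↑ n
  ↑-nonNeg n = ℚP.nonNegative⁻¹ (↑ n)

  0≤1 : 0ℚ ≤ 1ℚ
  0≤1 = subst (0ℚ ≤_) ↑1≡1 (↑-nonNeg 1)

  invℕ-nonNeg : ∀ n → 0ℚ ≤ invℕ n
  invℕ-nonNeg zero    = ℚP.≤-refl
  invℕ-nonNeg (suc d) = ℚP.nonNegative⁻¹ _ {{ℚP.normalize-nonNeg 1 (suc d)}}

  ↑*invℕ≡1 : ∀ d → ↑ suc d * invℕ (suc d) ≡ 1ℚ
  ↑*invℕ≡1 d = trans (cong (↑ suc d *_) (ℚP.normalize-coprime (1-coprimeTo (suc d))))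
                     (ℚP.*-inverseʳ (↑ suc d))

  *-monoˡ-≤ : ∀ {c a b} → 0ℚ ≤ c → a ≤ b → c * a ≤ c * b
  *-monoˡ-≤ {c} 0≤c = ℚP.*-monoˡ-≤-nonNeg c {{nonNegative 0≤c}}

  *-monoʳ-≤ : ∀ {c a b} → 0ℚ ≤ c → a ≤ b → a * c ≤ b * c
  *-monoʳ-≤ {c} 0≤c = ℚP.*-monoʳ-≤-nonNeg c {{nonNegative 0≤c}}

  *-mono-≤ : ∀ {a b c d} → 0ℚ ≤ b → 0ℚ ≤ c → a ≤ b → c ≤ d → a * c ≤ b * d
  *-mono-≤ 0≤b 0≤c a≤b c≤d = ℚP.≤-trans (*-monoʳ-≤ 0≤c a≤b) (*-monoˡ-≤ 0≤b c≤d)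

  *-nonNeg : ∀ {a b} → 0ℚ ≤ a → 0ℚ ≤ b → 0ℚ ≤ a * b
  *-nonNeg {b = b} 0≤a 0≤b = ℚP.≤-trans (ℚP.≤-reflexive (sym (ℚP.*-zeroˡ b))) (*-monoʳ-≤ 0≤b 0≤a)

  *-pos : ∀ {x y} → 0ℚ < x → 0ℚ < y → 0ℚ < x * y
  *-pos {x} {y} 0<x 0<y =
    ℚP.positive⁻¹ (x * y) {{ℚP.pos*pos⇒pos x {{positive 0<x}} y {{positive 0<y}}}}

  x≤x+y : ∀ {x y} → 0ℚ ≤ y → x ≤ x + y
  x≤x+y {x} 0≤y = ℚP.≤-trans (ℚP.≤-reflexive (sym (ℚP.+-identityʳ x))) (ℚP.+-monoʳ-≤ x 0≤y)

  y≤x+y : ∀ {x y} → 0ℚ ≤ x → y ≤ x + y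
  y≤x+y {x} {y} 0≤x = ℚP.≤-trans (x≤x+y 0≤x) (ℚP.≤-reflexive (ℚP.+-comm y x))

  +-nonNeg : ∀ {a b} → 0ℚ ≤ a → 0ℚ ≤ b → 0ℚ ≤ a + b
  +-nonNeg 0≤a 0≤b = ℚP.≤-trans 0≤a (x≤x+y 0≤b)

  x*x<y*y⇒x<y : ∀ {x y} → 0ℚ ≤ x → 0ℚ ≤ y → x * x < y * y → x < y
  x*x<y*y⇒x<y 0≤x 0≤y xx<yy =
    ℚP.≰⇒> (λ y≤x → ℚP.<-irrefl refl (ℚP.<-≤-trans xx<yy (*-mono-≤ 0≤x 0≤y y≤x y≤x)))

  ^-nonNeg : ∀ {x} r → 0ℚ ≤ x → 0ℚ ≤ x ^ r
  ^-nonNeg zero    0≤x = 0≤1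
  ^-nonNeg (suc r) 0≤x = *-nonNeg 0≤x (^-nonNeg r 0≤x)

  ^-mono-≤ : ∀ {x y} r → 0ℚ ≤ x → x ≤ y → x ^ r ≤ y ^ r
  ^-mono-≤ zero    0≤x x≤y = ℚP.≤-refl
  ^-mono-≤ (suc r) 0≤x x≤y =
    *-mono-≤ (ℚP.≤-trans 0≤x x≤y) (^-nonNeg r 0≤x) x≤y (^-mono-≤ r 0≤x x≤y)

  binomial-≤ : ∀ r {x d} → 0ℚ ≤ x → 0ℚ ≤ d →
               (x + d) ^ suc r ≤ x ^ suc r + ↑ suc r * ((x + d) ^ r * d)
  binomial-≤ zero {x} {d} _ _ = ℚP.≤-reflexive (begin-equality
    (x + d) * 1ℚ             ≡⟨ linear x d ⟩
    x * 1ℚ + 1ℚ * (1ℚ * d)   ≡⟨ cong (λ c → x * 1ℚ + c * (1ℚ * d)) (sym ↑1≡1) ⟩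
    x * 1ℚ + ↑ 1 * (1ℚ * d)  ∎)
    where
    open ℚP.≤-Reasoning
    linear : ∀ x d → (x + d) * 1ℚ ≡ x * 1ℚ + 1ℚ * (1ℚ * d)
    linear = solve 2 (λ x d → (x :+ d) :* con 1ℚ := x :* con 1ℚ :+ con 1ℚ :* (con 1ℚ :* d)) refl
  binomial-≤ (suc r) {x} {d} 0≤x 0≤d = begin
    (x + d) * (x + d) ^ suc r
      ≤⟨ *-monoˡ-≤ (+-nonNeg 0≤x 0≤d) (binomial-≤ r 0≤x 0≤d) ⟩
    (x + d) * (x ^ suc r + K * ((x + d) ^ r * d))
      ≡⟨ expand x d (x ^ suc r) K ((x + d) ^ r) ⟩
    x * x ^ suc r + d * x ^ suc r + K * ((x + d) ^ suc r * d)
      ≤⟨ ℚP.+-monoˡ-≤ (K * ((x + d) ^ suc r * d))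
           (ℚP.+-monoʳ-≤ (x * x ^ suc r) (*-monoˡ-≤ 0≤d (^-mono-≤ (suc r) 0≤x (x≤x+y 0≤d)))) ⟩
    x * x ^ suc r + d * (x + d) ^ suc r + K * ((x + d) ^ suc r * d)
      ≡⟨ collect (x * x ^ suc r) d ((x + d) ^ suc r) K ⟩
    x * x ^ suc r + (1ℚ + K) * ((x + d) ^ suc r * d)
      ≡⟨ cong (λ c → x * x ^ suc r + c * ((x + d) ^ suc r * d)) (sym (↑-suc (suc r))) ⟩
    x * x ^ suc r + ↑ suc (suc r) * ((x + d) ^ suc r * d)  ∎
    where
    open ℚP.≤-Reasoning
    K : ℚ
    K = ↑ suc r
    expand : ∀ x d X K Y → (x + d) * (X + K * (Y * d)) ≡ x * X + d * X + K * ((x + d) * Y * d)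
    expand = solve 5 (λ x d X K Y → (x :+ d) :* (X :+ K :* (Y :* d))
                                   := x :* X :+ d :* X :+ K :* ((x :+ d) :* Y :* d)) refl
    collect : ∀ A d Z K → A + d * Z + K * (Z * d) ≡ A + (1ℚ + K) * (Z * d)
    collect = solve 4 (λ A d Z K → A :+ d :* Z :+ K :* (Z :* d) := A :+ (con 1ℚ :+ K) :* (Z :* d)) refl

  invℕ-unique : ∀ d {y} → ↑ suc d * y ≡ 1ℚ → y ≡ invℕ (suc d)
  invℕ-unique d {y} ↑d*y≡1 = begin
    y                             ≡⟨ sym (ℚP.*-identityˡ y) ⟩
    1ℚ * y                        ≡⟨ cong (_* y) (sym (↑*invℕ≡1 d)) ⟩
    ↑ suc d * invℕ (suc d) * y    ≡⟨ xy∙z≈y∙xz (↑ suc d) (invℕ (suc d)) y ⟩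
    invℕ (suc d) * (↑ suc d * y)  ≡⟨ cong (invℕ (suc d) *_) ↑d*y≡1 ⟩
    invℕ (suc d) * 1ℚ             ≡⟨ ℚP.*-identityʳ (invℕ (suc d)) ⟩
    invℕ (suc d)                  ∎
    where open ≡-Reasoning

  invℕ-* : ∀ m n → invℕ (m *ℕ n) ≡ invℕ m * invℕ n
  invℕ-* zero    n       = sym (ℚP.*-zeroˡ (invℕ n))
  invℕ-* (suc m) zero    = trans (cong invℕ (ℕP.*-zeroʳ m)) (sym (ℚP.*-zeroʳ (invℕ (suc m))))
  invℕ-* (suc m) (suc n) = sym (invℕ-unique _ (begin
    ↑ (suc m *ℕ suc n) * (M⁻¹ * N⁻¹)  ≡⟨ cong (_* (M⁻¹ * N⁻¹)) (↑-* (suc m) (suc n)) ⟩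
    ↑ suc m * ↑ suc n * (M⁻¹ * N⁻¹)   ≡⟨ interchange (↑ suc m) (↑ suc n) M⁻¹ N⁻¹ ⟩
    (↑ suc m * M⁻¹) * (↑ suc n * N⁻¹) ≡⟨ cong₂ _*_ (↑*invℕ≡1 m) (↑*invℕ≡1 n) ⟩
    1ℚ * 1ℚ                           ≡⟨ ℚP.*-identityˡ 1ℚ ⟩
    1ℚ                                ∎))
    where
    open ≡-Reasoning
    M⁻¹ N⁻¹ : ℚ
    M⁻¹ = invℕ (suc m)
    N⁻¹ = invℕ (suc n)

  invℕ-^ : ∀ m k → invℕ (m ^ℕ k) ≡ invℕ m ^ k
  invℕ-^ m zero    = ↑1≡1
  invℕ-^ m (suc k) = trans (invℕ-* m (m ^ℕ k)) (cong (invℕ m *_) (invℕ-^ m k))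

  ↑*invℕ-mono-≤ : ∀ {a b c d} → 1 ≤ℕ b → 1 ≤ℕ d → a *ℕ d ≤ℕ c *ℕ b → ↑ a * invℕ b ≤ ↑ c * invℕ d
  ↑*invℕ-mono-≤ {a} {b@(suc b-1)} {c} {d@(suc d-1)} _ _ ad≤cb = begin
    ↑ a * invℕ b                    ≡⟨ sym (ℚP.*-identityʳ (↑ a * invℕ b)) ⟩
    ↑ a * invℕ b * 1ℚ               ≡⟨ cong (↑ a * invℕ b *_) (sym (↑*invℕ≡1 d-1)) ⟩
    ↑ a * invℕ b * (↑ d * invℕ d)   ≡⟨ interchange (↑ a) (invℕ b) (↑ d) (invℕ d) ⟩
    ↑ a * ↑ d * (invℕ b * invℕ d)   ≡⟨ cong (_* (invℕ b * invℕ d)) (sym (↑-* a d)) ⟩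
    ↑ (a *ℕ d) * (invℕ b * invℕ d)  ≤⟨ *-monoʳ-≤ (*-nonNeg (invℕ-nonNeg b) (invℕ-nonNeg d)) (↑-mono-≤ ad≤cb) ⟩
    ↑ (c *ℕ b) * (invℕ b * invℕ d)  ≡⟨ cong (_* (invℕ b * invℕ d)) (↑-* c b) ⟩
    ↑ c * ↑ b * (invℕ b * invℕ d)   ≡⟨ regroup (↑ c) (↑ b) (invℕ b) (invℕ d) ⟩
    ↑ c * invℕ d * (↑ b * invℕ b)   ≡⟨ cong (↑ c * invℕ d *_) (↑*invℕ≡1 b-1) ⟩
    ↑ c * invℕ d * 1ℚ               ≡⟨ ℚP.*-identityʳ (↑ c * invℕ d) ⟩
    ↑ c * invℕ d                    ∎
    where
    open ℚP.≤-Reasoning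
    regroup : ∀ c b B D → c * b * (B * D) ≡ c * D * (b * B)
    regroup = solve 4 (λ c b B D → c :* b :* (B :* D) := c :* D :* (b :* B)) refl

  invℕ-antimono-≤ : ∀ {m n} → 1 ≤ℕ m → m ≤ℕ n → invℕ n ≤ invℕ m
  invℕ-antimono-≤ {m} {n} 1≤m m≤n = begin
    invℕ n        ≡⟨ sym (ℚP.*-identityˡ (invℕ n)) ⟩
    1ℚ * invℕ n   ≡⟨ cong (_* invℕ n) (sym ↑1≡1) ⟩
    ↑ 1 * invℕ n  ≤⟨ ↑*invℕ-mono-≤ (ℕP.≤-trans 1≤m m≤n) 1≤m (ℕP.*-monoʳ-≤ 1 m≤n) ⟩
    ↑ 1 * invℕ m  ≡⟨ cong (_* invℕ m) ↑1≡1 ⟩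
    1ℚ * invℕ m   ≡⟨ ℚP.*-identityˡ (invℕ m) ⟩
    invℕ m        ∎
    where open ℚP.≤-Reasoning

  invℕ-partialFractions : ∀ {a b} → 1 ≤ℕ a → 1 ≤ℕ b →
                          invℕ a * invℕ b ≡ invℕ (a +ℕ b) * (invℕ a + invℕ b)
  invℕ-partialFractions {a@(suc a-1)} {b@(suc b-1)} _ _ = begin
    A * B                                ≡⟨ sym (ℚP.*-identityˡ (A * B)) ⟩
    1ℚ * (A * B)                         ≡⟨ cong (_* (A * B)) (sym (↑*invℕ≡1 (a-1 +ℕ b))) ⟩
    ↑ (a +ℕ b) * C * (A * B)             ≡⟨ cong (λ s → s * C * (A * B)) (↑-+ a b) ⟩
    (↑ a + ↑ b) * C * (A * B)            ≡⟨ distribute (↑ a) (↑ b) C A B ⟩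
    C * ((↑ a * A) * B + (↑ b * B) * A)
      ≡⟨ cong₂ (λ s t → C * (s * B + t * A)) (↑*invℕ≡1 a-1) (↑*invℕ≡1 b-1) ⟩
    C * (1ℚ * B + 1ℚ * A)                ≡⟨ cong (C *_) (cong₂ _+_ (ℚP.*-identityˡ B) (ℚP.*-identityˡ A)) ⟩
    C * (B + A)                          ≡⟨ cong (C *_) (ℚP.+-comm B A) ⟩
    C * (A + B)                          ∎
    where
    open ≡-Reasoning
    A B C : ℚ
    A = invℕ a
    B = invℕ b
    C = invℕ (a +ℕ b)
    distribute : ∀ x y C A B → (x + y) * C * (A * B) ≡ C * ((x * A) * B + (y * B) * A)
    distribute = solve 5 (λ x y C A B → (x :+ y) :* C :* (A :* B)
                                       := C :* ((x :* A) :* B :+ (y :* B) :* A)) refl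

  invℕ-archimedean : ∀ {δ} → 0ℚ < δ → ∃ λ q → invℕ (suc q) < δ
  invℕ-archimedean {δ} 0<δ = archimedean δ (positive 0<δ)
    where
    archimedean : ∀ δ → Positive δ → ∃ λ q → invℕ (suc q) < δ
    archimedean (mkℚ (ℤ.+ suc p) d-1 _) _ = suc d-1 , (begin-strict
      invℕ (suc (suc d-1))     ≡⟨ ℚP.normalize-coprime (1-coprimeTo (suc (suc d-1))) ⟩
      mkℚ (ℤ.+ 1) (suc d-1) _
        <⟨ *<* (subst₂ ℤ._<_ (ℤP.pos-* 1 D) (ℤP.pos-* (suc p) (suc D)) (ℤ.+<+ D<[1+p][1+D])) ⟩
      mkℚ (ℤ.+ suc p) d-1 _    ∎)
      where
      open ℚP.≤-Reasoning
      D : ℕ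
      D = suc d-1
      D<[1+p][1+D] : 1 *ℕ D <ℕ suc p *ℕ suc D
      D<[1+p][1+D] = ℕP.<-≤-trans (ℕP.*-monoʳ-< 1 (ℕP.n<1+n D)) (ℕP.*-monoˡ-≤ (suc D) (s≤s (z≤n {p})))
    archimedean (mkℚ (ℤ.+ zero) _ _) record { pos = () }
    archimedean (mkℚ ℤ.-[1+ _ ] _ _) record { pos = () }

  ↑*invℕ-eventually-< : ∀ C {δ} → 0ℚ < δ → ∃ λ N₀ → ∀ N → N₀ ≤ℕ N → ↑ C * invℕ (suc N) < δ
  ↑*invℕ-eventually-< C 0<δ with invℕ-archimedean 0<δ
  ... | q , 1/[1+q]<δ = C *ℕ suc q , λ N N₀≤N → begin-strict
    ↑ C * invℕ (suc N)
      ≤⟨ ↑*invℕ-mono-≤ {C} {suc N} {1} {suc q} (s≤s z≤n) (s≤s z≤n) (C*[1+q]≤1*[1+N] N N₀≤N) ⟩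
    ↑ 1 * invℕ (suc q)  ≡⟨ cong (_* invℕ (suc q)) ↑1≡1 ⟩
    1ℚ * invℕ (suc q)   ≡⟨ ℚP.*-identityˡ (invℕ (suc q)) ⟩
    invℕ (suc q)        <⟨ 1/[1+q]<δ ⟩
    _                   ∎
    where
    open ℚP.≤-Reasoning
    C*[1+q]≤1*[1+N] : ∀ N → C *ℕ suc q ≤ℕ N → C *ℕ suc q ≤ℕ 1 *ℕ suc N
    C*[1+q]≤1*[1+N] N le =
      ℕP.≤-trans le (ℕP.≤-trans (ℕP.n≤1+n N) (ℕP.≤-reflexive (sym (ℕP.*-identityˡ (suc N)))))

  square-≤ : ∀ {s} x r C N → 0ℚ ≤ s → s ≤ x ^ r * invℕ (suc N) → x ^ (r +ℕ r) ≤ ↑ C * ↑ suc N →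
             s * s ≤ ↑ C * invℕ (suc N)
  square-≤ {s} x r C N 0≤s s≤X*W X²≤C*N = begin
    s * s                    ≤⟨ *-mono-≤ (ℚP.≤-trans 0≤s s≤X*W) 0≤s s≤X*W s≤X*W ⟩
    X * W * (X * W)          ≡⟨ interchange X W X W ⟩
    X * X * (W * W)          ≡⟨ cong (_* (W * W)) (sym (^-homo-* x r r)) ⟩
    x ^ (r +ℕ r) * (W * W)   ≤⟨ *-monoʳ-≤ (*-nonNeg (invℕ-nonNeg (suc N)) (invℕ-nonNeg (suc N))) X²≤C*N ⟩
    ↑ C * ↑ suc N * (W * W)  ≡⟨ regroup (↑ C) (↑ suc N) W ⟩
    ↑ C * (↑ suc N * W) * W  ≡⟨ cong (λ y → ↑ C * y * W) (↑*invℕ≡1 N) ⟩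
    ↑ C * 1ℚ * W             ≡⟨ cong (_* W) (ℚP.*-identityʳ (↑ C)) ⟩
    ↑ C * W                  ∎
    where
    open ℚP.≤-Reasoning
    X W : ℚ
    X = x ^ r
    W = invℕ (suc N)
    regroup : ∀ c n y → c * n * (y * y) ≡ c * (n * y) * y
    regroup = solve 3 (λ c n y → c :* n :* (y :* y) := c :* (n :* y) :* y) refl

  -- Sums over intervals

  <∸⇒+< : ∀ {m n i} → i <ℕ n ∸ m → m +ℕ i <ℕ n
  <∸⇒+< {zero}          i<n   = i<n
  <∸⇒+< {suc m} {suc n} i<n∸m = s≤s (<∸⇒+< {m} {n} i<n∸m)

  sumUpTo : ℕ → (ℕ → ℚ) → ℚ
  sumUpTo g φ = sumℚ (applyUpTo φ g)

  sumUpTo-mono-≤ : ∀ g {φ ψ} → (∀ i → i <ℕ g → φ i ≤ ψ i) → sumUpTo g φ ≤ sumUpTo g ψ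
  sumUpTo-mono-≤ zero    φ≤ψ = ℚP.≤-refl
  sumUpTo-mono-≤ (suc g) φ≤ψ =
    ℚP.+-mono-≤ (φ≤ψ 0 z<s) (sumUpTo-mono-≤ g (λ i i<g → φ≤ψ (suc i) (s≤s i<g)))

  sumUpTo-nonNeg : ∀ g {φ} → (∀ i → i <ℕ g → 0ℚ ≤ φ i) → 0ℚ ≤ sumUpTo g φ
  sumUpTo-nonNeg zero    0≤φ = ℚP.≤-refl
  sumUpTo-nonNeg (suc g) 0≤φ =
    +-nonNeg (0≤φ 0 z<s) (sumUpTo-nonNeg g (λ i i<g → 0≤φ (suc i) (s≤s i<g)))

  sumUpTo-*ˡ : ∀ g c φ → sumUpTo g (λ i → c * φ i) ≡ c * sumUpTo g φ
  sumUpTo-*ˡ zero    c φ = sym (ℚP.*-zeroʳ c)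
  sumUpTo-*ˡ (suc g) c φ = trans (cong (c * φ 0 +_) (sumUpTo-*ˡ g c (φ ∘ suc)))
                                 (sym (ℚP.*-distribˡ-+ c (φ 0) (sumUpTo g (φ ∘ suc))))

  sumUpTo-+ : ∀ g φ ψ → sumUpTo g (λ i → φ i + ψ i) ≡ sumUpTo g φ + sumUpTo g ψ
  sumUpTo-+ zero    φ ψ = sym (ℚP.+-identityʳ 0ℚ)
  sumUpTo-+ (suc g) φ ψ = trans (cong (φ 0 + ψ 0 +_) (sumUpTo-+ g (φ ∘ suc) (ψ ∘ suc)))
                                (+-interchange (φ 0) (ψ 0) (sumUpTo g (φ ∘ suc)) (sumUpTo g (ψ ∘ suc)))

  sumUpTo-suc : ∀ g φ → sumUpTo (suc g) φ ≡ sumUpTo g φ + φ g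
  sumUpTo-suc zero    φ = trans (ℚP.+-identityʳ (φ 0)) (sym (ℚP.+-identityˡ (φ 0)))
  sumUpTo-suc (suc g) φ = trans (cong (φ 0 +_) (sumUpTo-suc g (φ ∘ suc)))
                                (sym (ℚP.+-assoc (φ 0) (sumUpTo g (φ ∘ suc)) (φ (suc g))))

  sumUpTo-pred-≤ : ∀ g {φ} → (∀ i → 0ℚ ≤ φ i) → sumUpTo (pred g) (φ ∘ suc) ≤ sumUpTo g φ
  sumUpTo-pred-≤ zero    0≤φ = ℚP.≤-refl
  sumUpTo-pred-≤ (suc g) 0≤φ = y≤x+y (0≤φ 0)

  -- Opaque so that the bounds lo and N can be read off a sum by unification.
  opaque
    sumBetween : ℕ → ℕ → (ℕ → ℚ) → ℚ
    sumBetween lo N f = sumUpTo (N ∸ suc lo) (λ i → f (suc lo +ℕ i))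

  syntax sumBetween lo N (λ n → e) = Σ[ lo < n < N ] e

  opaque
    unfolding sumBetween

    sumℚ-openRange : ∀ lo N f → sumℚ (map f (openRange lo N)) ≡ Σ[ lo < n < N ] f n
    sumℚ-openRange lo N f = cong sumℚ (trans (cong (map f) (map-applyUpTo id (suc lo +ℕ_) (N ∸ suc lo)))
                                             (map-applyUpTo (suc lo +ℕ_) f (N ∸ suc lo)))

    Σ-mono-≤ : ∀ {lo N} {f g : ℕ → ℚ} → (∀ n → lo <ℕ n → n <ℕ N → f n ≤ g n) →
               Σ[ lo < n < N ] f n ≤ Σ[ lo < n < N ] g n
    Σ-mono-≤ {lo} {N} f≤g =
      sumUpTo-mono-≤ (N ∸ suc lo) (λ i i<g → f≤g _ (s≤s (ℕP.m≤m+n lo i)) (<∸⇒+< i<g))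

    Σ-nonNeg : ∀ {lo N} {f : ℕ → ℚ} → (∀ n → lo <ℕ n → n <ℕ N → 0ℚ ≤ f n) → 0ℚ ≤ Σ[ lo < n < N ] f n
    Σ-nonNeg {lo} {N} 0≤f =
      sumUpTo-nonNeg (N ∸ suc lo) (λ i i<g → 0≤f _ (s≤s (ℕP.m≤m+n lo i)) (<∸⇒+< i<g))

    Σ-*ˡ : ∀ {lo N} c (f : ℕ → ℚ) → Σ[ lo < n < N ] (c * f n) ≡ c * Σ[ lo < n < N ] f n
    Σ-*ˡ {lo} {N} c f = sumUpTo-*ˡ (N ∸ suc lo) c (λ i → f (suc lo +ℕ i))

    Σ-+ : ∀ {lo N} (f g : ℕ → ℚ) →
          Σ[ lo < n < N ] (f n + g n) ≡ Σ[ lo < n < N ] f n + Σ[ lo < n < N ] g n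
    Σ-+ {lo} {N} f g = sumUpTo-+ (N ∸ suc lo) (λ i → f (suc lo +ℕ i)) (λ i → g (suc lo +ℕ i))

    Σ-suc-≤ : ∀ {lo N} {f : ℕ → ℚ} → (∀ n → 0ℚ ≤ f n) → Σ[ suc lo < n < N ] f n ≤ Σ[ lo < n < N ] f n
    Σ-suc-≤ {lo} {N} {f} 0≤f = begin
      sumUpTo (N ∸ suc (suc lo)) (λ i → f (suc (suc lo) +ℕ i))
        ≡⟨ cong (λ g → sumUpTo g (λ i → f (suc (suc lo) +ℕ i))) (sym (ℕP.pred[m∸n]≡m∸[1+n] N (suc lo))) ⟩
      sumUpTo (pred (N ∸ suc lo)) (λ i → f (suc (suc lo) +ℕ i))
        ≤⟨ sumUpTo-mono-≤ (pred (N ∸ suc lo)) (λ i _ → ℚP.≤-reflexive (cong f (sym (ℕP.+-suc (suc lo) i)))) ⟩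
      sumUpTo (pred (N ∸ suc lo)) (λ i → f (suc lo +ℕ suc i))
        ≤⟨ sumUpTo-pred-≤ (N ∸ suc lo) (λ i → 0≤f (suc lo +ℕ i)) ⟩
      sumUpTo (N ∸ suc lo) (λ i → f (suc lo +ℕ i))
        ∎
      where open ℚP.≤-Reasoning

  Σ-antitone : ∀ {lo lo′ N} {f : ℕ → ℚ} → lo ≤ℕ lo′ → (∀ n → 0ℚ ≤ f n) →
               Σ[ lo′ < n < N ] f n ≤ Σ[ lo < n < N ] f n
  Σ-antitone {lo} {N = N} {f} lo≤lo′ 0≤f = go (ℕP.≤⇒≤′ lo≤lo′)
    where
    go : ∀ {m} → lo ≤′ m → Σ[ m < n < N ] f n ≤ Σ[ lo < n < N ] f n
    go ≤′-refl         = ℚP.≤-refl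
    go (≤′-step lo≤′m) = ℚP.≤-trans (Σ-suc-≤ {N = N} {f} 0≤f) (go lo≤′m)

  -- Harmonic numbers

  harmonic : ℕ → ℚ
  harmonic n = Σ[ 0 < d < n ] invℕ d

  harmonic-nonNeg : ∀ n → 0ℚ ≤ harmonic n
  harmonic-nonNeg n = Σ-nonNeg (λ d _ _ → invℕ-nonNeg d)

  opaque
    unfolding sumBetween

    harmonic1≡0 : harmonic 1 ≡ 0ℚ
    harmonic1≡0 = refl

    harmonic-suc : ∀ n → harmonic (suc (suc n)) ≡ harmonic (suc n) + invℕ (suc n)
    harmonic-suc n = sumUpTo-suc n (invℕ ∘ suc)

    harmonic-reflect : ∀ N → Σ[ 0 < n < N ] invℕ (N ∸ n) ≡ harmonic N
    harmonic-reflect zero    = refl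
    harmonic-reflect (suc g) = reversed g
      where
      reversed : ∀ g → sumUpTo g (λ i → invℕ (g ∸ i)) ≡ sumUpTo g (invℕ ∘ suc)
      reversed zero    = refl
      reversed (suc g) = begin
        invℕ (suc g) + sumUpTo g (λ i → invℕ (g ∸ i))  ≡⟨ cong (invℕ (suc g) +_) (reversed g) ⟩
        invℕ (suc g) + sumUpTo g (invℕ ∘ suc)          ≡⟨ ℚP.+-comm (invℕ (suc g)) (sumUpTo g (invℕ ∘ suc)) ⟩
        sumUpTo g (invℕ ∘ suc) + invℕ (suc g)          ≡⟨ sym (sumUpTo-suc g (invℕ ∘ suc)) ⟩
        sumUpTo (suc g) (invℕ ∘ suc)                   ∎
        where open ≡-Reasoning

  Λ : ℕ → ℚ
  Λ N = harmonic N + harmonic N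

  Λ-nonNeg : ∀ N → 0ℚ ≤ Λ N
  Λ-nonNeg N = +-nonNeg (harmonic-nonNeg N) (harmonic-nonNeg N)

  harmonic≤Λ : ∀ N → harmonic N ≤ Λ N
  harmonic≤Λ N = x≤x+y (harmonic-nonNeg N)

  Λ-suc : ∀ N → Λ (suc (suc N)) ≡ Λ (suc N) + (invℕ (suc N) + invℕ (suc N))
  Λ-suc N = trans (cong₂ _+_ (harmonic-suc N) (harmonic-suc N))
                  (+-interchange (harmonic (suc N)) (invℕ (suc N)) (harmonic (suc N)) (invℕ (suc N)))

  ↑[2+N]*2/[1+N]≤4 : ∀ N → ↑ suc (suc N) * (invℕ (suc N) + invℕ (suc N)) ≤ ↑ 4
  ↑[2+N]*2/[1+N]≤4 N = begin
    ↑ suc (suc N) * (x + x)                ≡⟨ ℚP.*-distribˡ-+ (↑ suc (suc N)) x x ⟩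
    ↑ suc (suc N) * x + ↑ suc (suc N) * x  ≤⟨ ℚP.+-mono-≤ [2+N]/[1+N]≤2 [2+N]/[1+N]≤2 ⟩
    ↑ 2 + ↑ 2                              ≡⟨ sym (↑-+ 2 2) ⟩
    ↑ 4                                    ∎
    where
    open ℚP.≤-Reasoning
    x : ℚ
    x = invℕ (suc N)
    [2+N]*1+N≡2*[1+N] : ∀ N → suc (suc N) *ℕ 1 +ℕ N ≡ 2 *ℕ suc N
    [2+N]*1+N≡2*[1+N] = solve-∀
    [2+N]/[1+N]≤2 : ↑ suc (suc N) * x ≤ ↑ 2
    [2+N]/[1+N]≤2 = ℚP.≤-trans
      (↑*invℕ-mono-≤ {suc (suc N)} {suc N} {2} {1} (s≤s z≤n) (s≤s z≤n)
        (ℕP.≤-trans (ℕP.m≤m+n _ N) (ℕP.≤-reflexive ([2+N]*1+N≡2*[1+N] N))))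
      (ℚP.≤-reflexive (ℚP.*-identityʳ (↑ 2)))

  -- Induction on N: by binomial-≤, the step from Λ (N + 1) to Λ (N + 2) = Λ (N + 1) + 2/(N + 1)
  -- raises Λ^(r+1) by at most (r + 1) Λ (N + 2)^r 2/(N + 1), a constant by the bound for r.
  Λ^-≤-linear : ∀ r → ∃ λ C → ∀ N → Λ (suc N) ^ r ≤ ↑ C * ↑ suc N
  Λ^-≤-linear zero = 1 , λ N → begin
    1ℚ               ≡⟨ sym ↑1≡1 ⟩
    ↑ 1              ≤⟨ ↑-mono-≤ (s≤s z≤n) ⟩
    ↑ (1 *ℕ suc N)   ≡⟨ ↑-* 1 (suc N) ⟩
    ↑ 1 * ↑ suc N    ∎
    where open ℚP.≤-Reasoning
  Λ^-≤-linear (suc r) with Λ^-≤-linear r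
  ... | C , Λ^r≤C*N = C′ , bound
    where
    open ℚP.≤-Reasoning
    C′ : ℕ
    C′ = suc r *ℕ (C *ℕ 4)

    bound : ∀ N → Λ (suc N) ^ suc r ≤ ↑ C′ * ↑ suc N
    bound zero = begin
      Λ 1 * Λ 1 ^ r        ≡⟨ cong (λ h → (h + h) * Λ 1 ^ r) harmonic1≡0 ⟩
      (0ℚ + 0ℚ) * Λ 1 ^ r  ≡⟨ cong (_* Λ 1 ^ r) (ℚP.+-identityˡ 0ℚ) ⟩
      0ℚ * Λ 1 ^ r         ≡⟨ ℚP.*-zeroˡ (Λ 1 ^ r) ⟩
      0ℚ                   ≤⟨ *-nonNeg (↑-nonNeg C′) (↑-nonNeg 1) ⟩
      ↑ C′ * ↑ 1           ∎
    bound (suc N) = begin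
      Λ (suc (suc N)) ^ suc r
        ≡⟨ cong (_^ suc r) (Λ-suc N) ⟩
      (Λ (suc N) + d) ^ suc r
        ≤⟨ binomial-≤ r (Λ-nonNeg (suc N)) 0≤d ⟩
      Λ (suc N) ^ suc r + ↑ suc r * ((Λ (suc N) + d) ^ r * d)
        ≡⟨ cong (λ y → Λ (suc N) ^ suc r + ↑ suc r * (y ^ r * d)) (sym (Λ-suc N)) ⟩
      Λ (suc N) ^ suc r + ↑ suc r * (Λ (suc (suc N)) ^ r * d)
        ≤⟨ ℚP.+-mono-≤ (bound N) (*-monoˡ-≤ (↑-nonNeg (suc r)) (*-monoʳ-≤ 0≤d (Λ^r≤C*N (suc N)))) ⟩
      ↑ C′ * ↑ suc N + ↑ suc r * (↑ C * ↑ suc (suc N) * d)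
        ≤⟨ ℚP.+-monoʳ-≤ (↑ C′ * ↑ suc N) increment≤C′ ⟩
      ↑ C′ * ↑ suc N + ↑ C′
        ≡⟨ sym (trans (cong (↑ C′ *_) (↑-suc (suc N))) (distrib (↑ C′) (↑ suc N))) ⟩
      ↑ C′ * ↑ suc (suc N)
        ∎
      where
      d : ℚ
      d = invℕ (suc N) + invℕ (suc N)
      0≤d : 0ℚ ≤ d
      0≤d = +-nonNeg (invℕ-nonNeg (suc N)) (invℕ-nonNeg (suc N))
      increment≤C′ : ↑ suc r * (↑ C * ↑ suc (suc N) * d) ≤ ↑ C′
      increment≤C′ = begin
        ↑ suc r * (↑ C * ↑ suc (suc N) * d)
          ≡⟨ cong (↑ suc r *_) (ℚP.*-assoc (↑ C) (↑ suc (suc N)) d) ⟩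
        ↑ suc r * (↑ C * (↑ suc (suc N) * d))
          ≤⟨ *-monoˡ-≤ (↑-nonNeg (suc r)) (*-monoˡ-≤ (↑-nonNeg C) (↑[2+N]*2/[1+N]≤4 N)) ⟩
        ↑ suc r * (↑ C * ↑ 4)
          ≡⟨ sym (trans (↑-* (suc r) (C *ℕ 4)) (cong (↑ suc r *_) (↑-* C 4))) ⟩
        ↑ C′
          ∎
      distrib : ∀ c n → c * (1ℚ + n) ≡ c * n + c
      distrib = solve 2 (λ c n → c :* (con 1ℚ :+ n) := c :* n :+ c) refl

  -- Estimates for fixed N

  <⇒0< : ∀ {m n} → m <ℕ n → 0 <ℕ n
  <⇒0< = ℕP.≤-trans (s≤s z≤n)

  2≤+⇒1≤ʳ⊎2≤ˡ : ∀ e f → 2 ≤ℕ e +ℕ f → 1 ≤ℕ f ⊎ 2 ≤ℕ e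
  2≤+⇒1≤ʳ⊎2≤ˡ e zero    2≤e+0 = inj₂ (subst (2 ≤ℕ_) (ℕP.+-identityʳ e) 2≤e+0)
  2≤+⇒1≤ʳ⊎2≤ˡ e (suc f) _     = inj₁ (s≤s z≤n)

  module _ (N : ℕ) where

    u v p : ℕ → ℚ
    u n = invℕ (N ∸ n)
    v n = invℕ n
    p n = u n + v n

    w : ℚ
    w = invℕ N

    u-nonNeg : ∀ n → 0ℚ ≤ u n
    u-nonNeg n = invℕ-nonNeg (N ∸ n)

    p-nonNeg : ∀ n → 0ℚ ≤ p n
    p-nonNeg n = +-nonNeg (u-nonNeg n) (invℕ-nonNeg n)

    u-mono-≤ : ∀ {n m} → n ≤ℕ m → m <ℕ N → u n ≤ u m
    u-mono-≤ n≤m m<N = invℕ-antimono-≤ (ℕP.m<n⇒0<n∸m m<N) (ℕP.∸-monoʳ-≤ N n≤m)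

    u*v≡w*p : ∀ {n} → 0 <ℕ n → n <ℕ N → u n * v n ≡ w * p n
    u*v≡w*p {n} 0<n n<N = trans (invℕ-partialFractions (ℕP.m<n⇒0<n∸m n<N) 0<n)
                                (cong (λ m → invℕ m * p n) (ℕP.m∸n+n≡m (ℕP.<⇒≤ n<N)))

    Σu≤harmonic : ∀ lo → Σ[ lo < n < N ] u n ≤ harmonic N
    Σu≤harmonic lo = ℚP.≤-trans (Σ-antitone {f = u} z≤n u-nonNeg) (ℚP.≤-reflexive (harmonic-reflect N))

    Σv≤harmonic : ∀ lo → Σ[ lo < n < N ] v n ≤ harmonic N
    Σv≤harmonic lo = Σ-antitone {f = v} z≤n invℕ-nonNeg

    Σp≤Λ : ∀ lo → Σ[ lo < n < N ] p n ≤ Λ N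
    Σp≤Λ lo = ℚP.≤-trans (ℚP.≤-reflexive (Σ-+ u v)) (ℚP.+-mono-≤ (Σu≤harmonic lo) (Σv≤harmonic lo))

    u*Σv≤w*Λ : ∀ n → u n * Σ[ n < m < N ] v m ≤ w * Λ N
    u*Σv≤w*Λ n = begin
      u n * Σ[ n < m < N ] v m
        ≡⟨ sym (Σ-*ˡ (u n) v) ⟩
      Σ[ n < m < N ] (u n * v m)
        ≤⟨ Σ-mono-≤ (λ m n<m m<N → *-monoʳ-≤ (invℕ-nonNeg m) (u-mono-≤ (ℕP.<⇒≤ n<m) m<N)) ⟩
      Σ[ n < m < N ] (u m * v m)
        ≤⟨ Σ-mono-≤ (λ m n<m m<N → ℚP.≤-reflexive (u*v≡w*p (<⇒0< n<m) m<N)) ⟩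
      Σ[ n < m < N ] (w * p m)
        ≡⟨ Σ-*ˡ w p ⟩
      w * Σ[ n < m < N ] p m
        ≤⟨ *-monoˡ-≤ (invℕ-nonNeg N) (Σp≤Λ n) ⟩
      w * Λ N
        ∎
      where open ℚP.≤-Reasoning

    factor-nonNeg : ∀ n e f → 0ℚ ≤ factor N n e f
    factor-nonNeg n e f = invℕ-nonNeg ((N ∸ n) ^ℕ e *ℕ n ^ℕ f)

    factor-≤ : ∀ {n} e f k l → 0 <ℕ n → n <ℕ N → k ≤ℕ e → l ≤ℕ f → factor N n e f ≤ u n ^ k * v n ^ l
    factor-≤ {n} e f k l 0<n n<N k≤e l≤f = begin
      invℕ ((N ∸ n) ^ℕ e *ℕ n ^ℕ f)
        ≤⟨ invℕ-antimono-≤ 1≤[N-n]^k*n^l (ℕP.*-mono-≤ (ℕP.^-monoʳ-≤ (N ∸ n) k≤e) (ℕP.^-monoʳ-≤ n l≤f)) ⟩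
      invℕ ((N ∸ n) ^ℕ k *ℕ n ^ℕ l)
        ≡⟨ invℕ-* ((N ∸ n) ^ℕ k) (n ^ℕ l) ⟩
      invℕ ((N ∸ n) ^ℕ k) * invℕ (n ^ℕ l)
        ≡⟨ cong₂ _*_ (invℕ-^ (N ∸ n) k) (invℕ-^ n l) ⟩
      u n ^ k * v n ^ l
        ∎
      where
      open ℚP.≤-Reasoning
      instance
        N∸n-nonZero : ℕ.NonZero (N ∸ n)
        N∸n-nonZero = ℕ.>-nonZero (ℕP.m<n⇒0<n∸m n<N)
        n-nonZero : ℕ.NonZero n
        n-nonZero = ℕ.>-nonZero 0<n
      1≤[N-n]^k*n^l : 1 ≤ℕ (N ∸ n) ^ℕ k *ℕ n ^ℕ l
      1≤[N-n]^k*n^l = ℕP.*-mono-≤ (ℕP.m^n>0 (N ∸ n) k) (ℕP.m^n>0 n l)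

    factor-≤-u : ∀ {n} e f → 0 <ℕ n → n <ℕ N → 1 ≤ℕ e → factor N n e f ≤ u n
    factor-≤-u {n} e f 0<n n<N 1≤e = ℚP.≤-trans (factor-≤ e f 1 0 0<n n<N 1≤e z≤n)
      (ℚP.≤-reflexive (trans (ℚP.*-identityʳ (u n * 1ℚ)) (ℚP.*-identityʳ (u n))))

    factor-≤-v : ∀ {n} e f → 0 <ℕ n → n <ℕ N → 1 ≤ℕ f → factor N n e f ≤ v n
    factor-≤-v {n} e f 0<n n<N 1≤f = ℚP.≤-trans (factor-≤ e f 0 1 0<n n<N z≤n 1≤f)
      (ℚP.≤-reflexive (trans (ℚP.*-identityˡ (v n * 1ℚ)) (ℚP.*-identityʳ (v n))))

    factor-≤-uu : ∀ {n} e f → 0 <ℕ n → n <ℕ N → 2 ≤ℕ e → factor N n e f ≤ u n * u n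
    factor-≤-uu {n} e f 0<n n<N 2≤e = ℚP.≤-trans (factor-≤ e f 2 0 0<n n<N 2≤e z≤n)
      (ℚP.≤-reflexive (trans (ℚP.*-identityʳ (u n * (u n * 1ℚ))) (cong (u n *_) (ℚP.*-identityʳ (u n)))))

    factor-≤-uv : ∀ {n} e f → 0 <ℕ n → n <ℕ N → 1 ≤ℕ e → 1 ≤ℕ f → factor N n e f ≤ u n * v n
    factor-≤-uv {n} e f 0<n n<N 1≤e 1≤f = ℚP.≤-trans (factor-≤ e f 1 1 0<n n<N 1≤e 1≤f)
      (ℚP.≤-reflexive (cong₂ _*_ (ℚP.*-identityʳ (u n)) (ℚP.*-identityʳ (v n))))

    factor-≤-p : ∀ {n} e f → 0 <ℕ n → n <ℕ N → 1 ≤ℕ e +ℕ f → factor N n e f ≤ p n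
    factor-≤-p {n} zero    f 0<n n<N 1≤f =
      ℚP.≤-trans (factor-≤-v 0 f 0<n n<N 1≤f) (y≤x+y (u-nonNeg n))
    factor-≤-p {n} (suc e) f 0<n n<N _   =
      ℚP.≤-trans (factor-≤-u (suc e) f 0<n n<N (s≤s z≤n)) (x≤x+y (invℕ-nonNeg n))

    factor-≤-vp : ∀ {n} e f → 0 <ℕ n → n <ℕ N → 1 ≤ℕ f → 2 ≤ℕ e +ℕ f → factor N n e f ≤ v n * p n
    factor-≤-vp {n} zero f 0<n n<N _ 2≤f = begin
      factor N n 0 f
        ≤⟨ factor-≤ 0 f 0 2 0<n n<N z≤n 2≤f ⟩
      1ℚ * (v n * (v n * 1ℚ))
        ≡⟨ trans (ℚP.*-identityˡ (v n * (v n * 1ℚ))) (cong (v n *_) (ℚP.*-identityʳ (v n))) ⟩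
      v n * v n
        ≤⟨ *-monoˡ-≤ (invℕ-nonNeg n) (y≤x+y (u-nonNeg n)) ⟩
      v n * p n
        ∎
      where open ℚP.≤-Reasoning
    factor-≤-vp {n} (suc e) f 0<n n<N 1≤f _ = begin
      factor N n (suc e) f  ≤⟨ factor-≤-uv (suc e) f 0<n n<N (s≤s z≤n) 1≤f ⟩
      u n * v n             ≡⟨ ℚP.*-comm (u n) (v n) ⟩
      v n * u n             ≤⟨ *-monoˡ-≤ (invℕ-nonNeg n) (x≤x+y (invℕ-nonNeg n)) ⟩
      v n * p n             ∎
      where open ℚP.≤-Reasoning

    nestedSum-suc : ∀ k (a b : Fin (suc k) → ℕ) lo →
                    nestedSum (suc k) a b lo N ≡
                    Σ[ lo < n < N ] (factor N n (head a) (head b) * nestedSum k (tail a) (tail b) n N)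
    nestedSum-suc k a b lo = sumℚ-openRange lo N _

    nestedSum-nonNeg : ∀ k (a b : Fin k → ℕ) lo → 0ℚ ≤ nestedSum k a b lo N
    nestedSum-nonNeg zero    a b lo = 0≤1
    nestedSum-nonNeg (suc k) a b lo = ℚP.≤-trans
      (Σ-nonNeg λ n _ _ →
         *-nonNeg (factor-nonNeg n (head a) (head b)) (nestedSum-nonNeg k (tail a) (tail b) n))
      (ℚP.≤-reflexive (sym (nestedSum-suc k a b lo)))

    summand-≤ : ∀ {k} (a b : Fin (suc k) → ℕ) n {F T} → 0ℚ ≤ F →
                factor N n (head a) (head b) ≤ F → nestedSum k (tail a) (tail b) n N ≤ T →
                factor N n (head a) (head b) * nestedSum k (tail a) (tail b) n N ≤ F * T
    summand-≤ a b n 0≤F factor≤F nestedSum≤T =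
      *-mono-≤ 0≤F (nestedSum-nonNeg _ (tail a) (tail b) n) factor≤F nestedSum≤T

    nestedSum-≤-*Λ : ∀ {k} (a b : Fin (suc k) → ℕ) {lo} c g → 0ℚ ≤ c → Σ[ lo < n < N ] g n ≤ Λ N →
                     (∀ n → lo <ℕ n → n <ℕ N →
                        factor N n (head a) (head b) * nestedSum k (tail a) (tail b) n N ≤ c * g n) →
                     nestedSum (suc k) a b lo N ≤ c * Λ N
    nestedSum-≤-*Λ {k} a b {lo} c g 0≤c Σg≤Λ summand≤c*g = begin
      nestedSum (suc k) a b lo N
        ≡⟨ nestedSum-suc k a b lo ⟩
      Σ[ lo < n < N ] (factor N n (head a) (head b) * nestedSum k (tail a) (tail b) n N)
        ≤⟨ Σ-mono-≤ summand≤c*g ⟩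
      Σ[ lo < n < N ] (c * g n)  ≡⟨ Σ-*ˡ c g ⟩
      c * Σ[ lo < n < N ] g n    ≤⟨ *-monoˡ-≤ 0≤c Σg≤Λ ⟩
      c * Λ N                    ∎
      where open ℚP.≤-Reasoning

    Λ^-nonNeg : ∀ k → 0ℚ ≤ Λ N ^ k
    Λ^-nonNeg k = ^-nonNeg k (Λ-nonNeg N)

    nestedSum-≤-Λ^suc* : ∀ {k} (a b : Fin (suc k) → ℕ) {lo} j X g → 0ℚ ≤ X → Σ[ lo < n < N ] g n ≤ Λ N →
                         (∀ n → lo <ℕ n → n <ℕ N → factor N n (head a) (head b) * nestedSum k (tail a) (tail b) n N
                                                    ≤ Λ N ^ j * X * g n) →
                         nestedSum (suc k) a b lo N ≤ Λ N ^ suc j * X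
    nestedSum-≤-Λ^suc* a b j X g 0≤X Σg≤Λ summand≤ = ℚP.≤-trans
      (nestedSum-≤-*Λ a b (Λ N ^ j * X) g (*-nonNeg (Λ^-nonNeg j) 0≤X) Σg≤Λ summand≤)
      (ℚP.≤-reflexive (xy∙z≈zx∙y (Λ N ^ j) X (Λ N)))

    nestedSum-≤-Λ^ : ∀ k (a b : Fin k → ℕ) lo → (∀ i → 1 ≤ℕ a i +ℕ b i) → nestedSum k a b lo N ≤ Λ N ^ k
    nestedSum-≤-Λ^ zero    a b lo deg≥1 = ℚP.≤-refl
    nestedSum-≤-Λ^ (suc k) a b lo deg≥1 = ℚP.≤-trans
      (nestedSum-≤-*Λ a b (Λ N ^ k) p (Λ^-nonNeg k) (Σp≤Λ lo) λ n lo<n n<N → begin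
        factor N n (head a) (head b) * nestedSum k (tail a) (tail b) n N
          ≤⟨ summand-≤ a b n (p-nonNeg n) (factor-≤-p (head a) (head b) (<⇒0< lo<n) n<N (deg≥1 zero))
                             (nestedSum-≤-Λ^ k (tail a) (tail b) n (deg≥1 ∘ suc)) ⟩
        p n * Λ N ^ k  ≡⟨ ℚP.*-comm (p n) (Λ N ^ k) ⟩
        Λ N ^ k * p n  ∎)
      (ℚP.≤-reflexive (ℚP.*-comm (Λ N ^ k) (Λ N)))
      where open ℚP.≤-Reasoning

    nestedSum-≤-Λ^*Σv : ∀ k (a b : Fin (suc k) → ℕ) lo → (∀ i → 1 ≤ℕ a i +ℕ b i) → 1 ≤ℕ b (fromℕ k) →
                        nestedSum (suc k) a b lo N ≤ Λ N ^ k * Σ[ lo < n < N ] v n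
    nestedSum-≤-Λ^*Σv zero a b lo deg≥1 1≤bₖ = begin
      nestedSum 1 a b lo N
        ≡⟨ nestedSum-suc 0 a b lo ⟩
      Σ[ lo < n < N ] (factor N n (head a) (head b) * 1ℚ)
        ≤⟨ Σ-mono-≤ (λ n lo<n n<N → ℚP.≤-trans (ℚP.≤-reflexive (ℚP.*-identityʳ _))
                                               (factor-≤-v (head a) (head b) (<⇒0< lo<n) n<N 1≤bₖ)) ⟩
      Σ[ lo < n < N ] v n
        ≡⟨ sym (ℚP.*-identityˡ _) ⟩
      1ℚ * Σ[ lo < n < N ] v n
        ∎
      where open ℚP.≤-Reasoning
    nestedSum-≤-Λ^*Σv (suc k) a b lo deg≥1 1≤bₖ =
      nestedSum-≤-Λ^suc* a b k (V lo) p (Σ-nonNeg (λ n _ _ → invℕ-nonNeg n)) (Σp≤Λ lo) λ n lo<n n<N → begin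
        factor N n (head a) (head b) * nestedSum (suc k) (tail a) (tail b) n N
          ≤⟨ summand-≤ a b n (p-nonNeg n) (factor-≤-p (head a) (head b) (<⇒0< lo<n) n<N (deg≥1 zero))
                             (nestedSum-≤-Λ^*Σv k (tail a) (tail b) n (deg≥1 ∘ suc) 1≤bₖ) ⟩
        p n * (Λ N ^ k * V n)
          ≤⟨ *-monoˡ-≤ (p-nonNeg n) (*-monoˡ-≤ (Λ^-nonNeg k) (Σ-antitone (ℕP.<⇒≤ lo<n) invℕ-nonNeg)) ⟩
        p n * (Λ N ^ k * V lo)  ≡⟨ ℚP.*-comm (p n) (Λ N ^ k * V lo) ⟩
        Λ N ^ k * V lo * p n    ∎
      where
      open ℚP.≤-Reasoning
      V : ℕ → ℚ
      V lo = Σ[ lo < n < N ] v n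

    nestedSum-≤-Λ^*w-of-2≤a₀ : ∀ k (a b : Fin (suc (suc k)) → ℕ) lo →
      (∀ i → 1 ≤ℕ a i +ℕ b i) → 1 ≤ℕ b (fromℕ (suc k)) → 2 ≤ℕ head a →
      nestedSum (suc (suc k)) a b lo N ≤ Λ N ^ suc (suc k) * w
    nestedSum-≤-Λ^*w-of-2≤a₀ k a b lo deg≥1 1≤bₖ 2≤a₀ =
      nestedSum-≤-Λ^suc* a b (suc k) w u (invℕ-nonNeg N) (ℚP.≤-trans (Σu≤harmonic lo) (harmonic≤Λ N))
        λ n lo<n n<N → begin
          factor N n (head a) (head b) * nestedSum (suc k) (tail a) (tail b) n N
            ≤⟨ summand-≤ a b n (*-nonNeg (u-nonNeg n) (u-nonNeg n))
                 (factor-≤-uu (head a) (head b) (<⇒0< lo<n) n<N 2≤a₀)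
                 (nestedSum-≤-Λ^*Σv k (tail a) (tail b) n (deg≥1 ∘ suc) 1≤bₖ) ⟩
          u n * u n * (Λ N ^ k * Σ[ n < m < N ] v m)
            ≡⟨ regroup (u n) (Λ N ^ k) (Σ[ n < m < N ] v m) ⟩
          u n * (Λ N ^ k * (u n * Σ[ n < m < N ] v m))
            ≤⟨ *-monoˡ-≤ (u-nonNeg n) (*-monoˡ-≤ (Λ^-nonNeg k) (u*Σv≤w*Λ n)) ⟩
          u n * (Λ N ^ k * (w * Λ N))
            ≡⟨ regroup′ (u n) (Λ N ^ k) w (Λ N) ⟩
          Λ N ^ suc k * w * u n
            ∎
      where
      open ℚP.≤-Reasoning
      regroup : ∀ x P V → x * x * (P * V) ≡ x * (P * (x * V))
      regroup = solve 3 (λ x P V → x :* x :* (P :* V) := x :* (P :* (x :* V))) refl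
      regroup′ : ∀ x P y L → x * (P * (y * L)) ≡ L * P * y * x
      regroup′ = solve 4 (λ x P y L → x :* (P :* (y :* L)) := L :* P :* y :* x) refl

    nestedSum-≤-Λ^*v-of-1≤b₀ : ∀ k (a b : Fin (suc k) → ℕ) lo →
      (∀ i → 1 ≤ℕ a i +ℕ b i) → 1 ≤ℕ head b → 2 ≤ℕ head a +ℕ head b → 1 ≤ℕ lo →
      nestedSum (suc k) a b lo N ≤ Λ N ^ suc k * v lo
    nestedSum-≤-Λ^*v-of-1≤b₀ k a b lo deg≥1 1≤b₀ 2≤deg₀ 1≤lo =
      nestedSum-≤-Λ^suc* a b k (v lo) p (invℕ-nonNeg lo) (Σp≤Λ lo) λ n lo<n n<N → begin
        factor N n (head a) (head b) * nestedSum k (tail a) (tail b) n N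
          ≤⟨ summand-≤ a b n (*-nonNeg (invℕ-nonNeg n) (p-nonNeg n))
               (factor-≤-vp (head a) (head b) (<⇒0< lo<n) n<N 1≤b₀ 2≤deg₀)
               (nestedSum-≤-Λ^ k (tail a) (tail b) n (deg≥1 ∘ suc)) ⟩
        v n * p n * Λ N ^ k
          ≤⟨ *-monoʳ-≤ (Λ^-nonNeg k) (*-monoʳ-≤ (p-nonNeg n) (invℕ-antimono-≤ 1≤lo (ℕP.<⇒≤ lo<n))) ⟩
        v lo * p n * Λ N ^ k  ≡⟨ xy∙z≈zx∙y (v lo) (p n) (Λ N ^ k) ⟩
        Λ N ^ k * v lo * p n  ∎
      where open ℚP.≤-Reasoning

    nestedSum-≤-Λ^*w-of-1≤a₀-1≤b₀ : ∀ k (a b : Fin (suc k) → ℕ) lo →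
      (∀ i → 1 ≤ℕ a i +ℕ b i) → 1 ≤ℕ head a → 1 ≤ℕ head b →
      nestedSum (suc k) a b lo N ≤ Λ N ^ suc k * w
    nestedSum-≤-Λ^*w-of-1≤a₀-1≤b₀ k a b lo deg≥1 1≤a₀ 1≤b₀ =
      nestedSum-≤-Λ^suc* a b k w p (invℕ-nonNeg N) (Σp≤Λ lo) λ n lo<n n<N → begin
        factor N n (head a) (head b) * nestedSum k (tail a) (tail b) n N
          ≤⟨ summand-≤ a b n (*-nonNeg (u-nonNeg n) (invℕ-nonNeg n))
               (factor-≤-uv (head a) (head b) (<⇒0< lo<n) n<N 1≤a₀ 1≤b₀)
               (nestedSum-≤-Λ^ k (tail a) (tail b) n (deg≥1 ∘ suc)) ⟩
        u n * v n * Λ N ^ k  ≡⟨ cong (_* Λ N ^ k) (u*v≡w*p (<⇒0< lo<n) n<N) ⟩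
        w * p n * Λ N ^ k    ≡⟨ xy∙z≈zx∙y w (p n) (Λ N ^ k) ⟩
        Λ N ^ k * w * p n    ∎
      where open ℚP.≤-Reasoning

    nestedSum-≤-Λ^*v : ∀ k (a b : Fin (suc k) → ℕ) lo →
      (∀ i → 1 ≤ℕ a i +ℕ b i) → 1 ≤ℕ b (fromℕ k) → ∃ (λ i → 2 ≤ℕ a i +ℕ b i) → 1 ≤ℕ lo → lo ≤ℕ N →
      nestedSum (suc k) a b lo N ≤ Λ N ^ suc k * v lo
    nestedSum-≤-Λ^*v zero a b lo deg≥1 1≤bₖ (zero , 2≤deg₀) 1≤lo _ =
      nestedSum-≤-Λ^*v-of-1≤b₀ zero a b lo deg≥1 1≤bₖ 2≤deg₀ 1≤lo
    nestedSum-≤-Λ^*v (suc k) a b lo deg≥1 1≤bₖ (suc i , 2≤degᵢ) 1≤lo _ =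
      nestedSum-≤-Λ^suc* a b (suc k) (v lo) p (invℕ-nonNeg lo) (Σp≤Λ lo) λ n lo<n n<N → begin
        factor N n (head a) (head b) * nestedSum (suc k) (tail a) (tail b) n N
          ≤⟨ summand-≤ a b n (p-nonNeg n) (factor-≤-p (head a) (head b) (<⇒0< lo<n) n<N (deg≥1 zero))
               (nestedSum-≤-Λ^*v k (tail a) (tail b) n (deg≥1 ∘ suc) 1≤bₖ (i , 2≤degᵢ)
                                 (<⇒0< lo<n) (ℕP.<⇒≤ n<N)) ⟩
        p n * (Λ N ^ suc k * v n)
          ≤⟨ *-monoˡ-≤ (p-nonNeg n) (*-monoˡ-≤ (Λ^-nonNeg (suc k)) (invℕ-antimono-≤ 1≤lo (ℕP.<⇒≤ lo<n))) ⟩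
        p n * (Λ N ^ suc k * v lo)  ≡⟨ ℚP.*-comm (p n) (Λ N ^ suc k * v lo) ⟩
        Λ N ^ suc k * v lo * p n    ∎
      where open ℚP.≤-Reasoning
    nestedSum-≤-Λ^*v (suc k) a b lo deg≥1 1≤bₖ (zero , 2≤deg₀) 1≤lo lo≤N
      with 2≤+⇒1≤ʳ⊎2≤ˡ (head a) (head b) 2≤deg₀
    ... | inj₁ 1≤b₀ = nestedSum-≤-Λ^*v-of-1≤b₀ (suc k) a b lo deg≥1 1≤b₀ 2≤deg₀ 1≤lo
    ... | inj₂ 2≤a₀ = ℚP.≤-trans (nestedSum-≤-Λ^*w-of-2≤a₀ k a b lo deg≥1 1≤bₖ 2≤a₀)
                                 (*-monoˡ-≤ (Λ^-nonNeg (suc (suc k))) (invℕ-antimono-≤ 1≤lo lo≤N))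

    nestedSum-≤-Λ^*w : ∀ k (a b : Fin (suc k) → ℕ) lo → 1 ≤ℕ head a →
      (∀ i → 1 ≤ℕ a i +ℕ b i) → 1 ≤ℕ b (fromℕ k) → ∃ (λ i → 2 ≤ℕ a i +ℕ b i) →
      nestedSum (suc k) a b lo N ≤ Λ N ^ suc k * w
    nestedSum-≤-Λ^*w zero a b lo 1≤a₀ deg≥1 1≤bₖ _ =
      nestedSum-≤-Λ^*w-of-1≤a₀-1≤b₀ zero a b lo deg≥1 1≤a₀ 1≤bₖ
    nestedSum-≤-Λ^*w (suc k) a b lo 1≤a₀ deg≥1 1≤bₖ (suc i , 2≤degᵢ) =
      nestedSum-≤-Λ^suc* a b (suc k) w p (invℕ-nonNeg N) (Σp≤Λ lo) λ n lo<n n<N → begin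
        factor N n (head a) (head b) * nestedSum (suc k) (tail a) (tail b) n N
          ≤⟨ summand-≤ a b n (u-nonNeg n) (factor-≤-u (head a) (head b) (<⇒0< lo<n) n<N 1≤a₀)
               (nestedSum-≤-Λ^*v k (tail a) (tail b) n (deg≥1 ∘ suc) 1≤bₖ (i , 2≤degᵢ)
                                 (<⇒0< lo<n) (ℕP.<⇒≤ n<N)) ⟩
        u n * (Λ N ^ suc k * v n)  ≡⟨ x∙yz≈y∙xz (u n) (Λ N ^ suc k) (v n) ⟩
        Λ N ^ suc k * (u n * v n)  ≡⟨ cong (Λ N ^ suc k *_) (u*v≡w*p (<⇒0< lo<n) n<N) ⟩
        Λ N ^ suc k * (w * p n)    ≡⟨ sym (ℚP.*-assoc (Λ N ^ suc k) w (p n)) ⟩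
        Λ N ^ suc k * w * p n      ∎
      where open ℚP.≤-Reasoning
    nestedSum-≤-Λ^*w (suc k) a b lo 1≤a₀ deg≥1 1≤bₖ (zero , 2≤deg₀)
      with 2≤+⇒1≤ʳ⊎2≤ˡ (head a) (head b) 2≤deg₀
    ... | inj₁ 1≤b₀ = nestedSum-≤-Λ^*w-of-1≤a₀-1≤b₀ (suc k) a b lo deg≥1 1≤a₀ 1≤b₀
    ... | inj₂ 2≤a₀ = nestedSum-≤-Λ^*w-of-2≤a₀ k a b lo deg≥1 1≤bₖ 2≤a₀

open import Data.Nat using (ℕ; suc; _≤_; _+_; s≤s)
open import Data.Fin using (Fin; zero; fromℕ)
open import Data.Product using (∃; _,_; proj₁; proj₂)
open import Data.Rational using (ℚ; 0ℚ; ∣_∣; _*_) renaming (_<_ to _<ℚ_; _≤_ to _≤ℚ_)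
import Data.Rational.Properties as ℚP
open import Relation.Binary.PropositionalEquality using (subst; sym)
open Estimates

lemma2p1 : (m : ℕ) → (a b : Fin (suc m) → ℕ)
    → 1 ≤ a zero
    → 1 ≤ b (fromℕ m)
    → (∀ i → 1 ≤ a i + b i)
    → ∃ (λ i → 2 ≤ a i + b i)
    → ∀ (ε : ℚ) → 0ℚ <ℚ ε
    → ∃ (λ N₀ → ∀ N → N₀ ≤ N → ∣ S (suc m) a b N ∣ <ℚ ε)
lemma2p1 m a b 1≤a₀ 1≤bₘ deg≥1 deg≥2 ε 0<ε = suc N₀ , S-small
  where
  C : ℕ
  C = proj₁ (Λ^-≤-linear (suc m + suc m))
  N₀ : ℕ
  N₀ = proj₁ (↑*invℕ-eventually-< C (*-pos 0<ε 0<ε))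

  S-small : ∀ N → suc N₀ ≤ N → ∣ S (suc m) a b N ∣ <ℚ ε
  S-small (suc N) (s≤s N₀≤N) =
    subst (_<ℚ ε) (sym (ℚP.0≤p⇒∣p∣≡p 0≤S)) (x*x<y*y⇒x<y 0≤S (ℚP.<⇒≤ 0<ε) S*S<ε*ε)
    where
    0≤S : 0ℚ ≤ℚ S (suc m) a b (suc N)
    0≤S = nestedSum-nonNeg (suc N) (suc m) a b 0
    S*S<ε*ε : S (suc m) a b (suc N) * S (suc m) a b (suc N) <ℚ ε * ε
    S*S<ε*ε = ℚP.≤-<-trans
      (square-≤ (Λ (suc N)) (suc m) C N 0≤S (nestedSum-≤-Λ^*w (suc N) m a b 0 1≤a₀ deg≥1 1≤bₘ deg≥2)
                (proj₂ (Λ^-≤-linear (suc m + suc m)) N))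
      (proj₂ (↑*invℕ-eventually-< C (*-pos 0<ε 0<ε)) N N₀≤N)
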